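{- Any derivation in Extended Polynomial Calculus over $\mathbb{Z}$ with the square root rule of an unsatisfiable CNF in $n$ variables from $\mathsf{eBVP}_n$ requires size $\Omega(2^{n/3})$.
   Context: $\mathsf{eBVP}_n$ is the equation $M + x_1 + 2x_2 + \ldots + 2^{n-1}x_n = 0$ for an integer $M>0$, together with the Boolean axioms $x_i^2 - x_i = 0$. Extended Polynomial Calculus over $\mathbb{Z}$ derives polynomials (read as equations $=0$) by integer linear combinations and multiplication by variables, allows extension axioms $y_j - q_j(\bar x, y_1,\ldots,y_{j-1})$ introducing new variables, and the square root rule derives $r$ from $r^2$; size is the total bit size of coefficients. Deriving an unsatisfiable CNF over $\mathbb{Z}$ means deriving equations $C_i\cdot y_{j_1}\cdots y_{j_k}\cdot\neg y_{\ell_1}\cdots\neg y_{\ell_r}=0$, one per clause, with nonzero integer constants $C_i$ (the $y$'s may be extension variables, $\neg y_\ell = 1-y_\ell$), and deriving $C'_j\cdot(y_j^2-y_j)=0$ with nonzero integer $C'_j$ for every variable $y_j$ of the CNF. -}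

module Defs where

open import Data.Nat as ℕ using (ℕ; zero; suc; _<_)
open import Data.Nat.Logarithm using (⌈log₂_⌉)
open import Data.Integer using (ℤ; +_; _+_; _*_; _-_; ∣_∣)
open import Data.Bool using (Bool; true; false)
open import Data.Fin using (Fin; toℕ)
open import Data.List using (List; []; _∷_; map; length; lookup; concatMap)
open import Data.Nat.ListAction using (sum)
open import Data.List.Relation.Unary.All using (All)
open import Data.List.Relation.Unary.Any using (Any)
open import Data.List.Relation.Unary.AllPairs using (AllPairs)
open import Data.List.Membership.Propositional using (_∈_)
open import Data.List.Relation.Binary.Permutation.Propositional using (_↭_)
open import Data.Product using (_×_; _,_; proj₁; proj₂; ∃; ∃-syntax)
open import Relation.Binary.PropositionalEquality using (_≡_; _≢_)
open import Relation.Nullary using (¬_)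

-- Variables: original variables x i (standing for x_{i+1}) and
-- extension variables y j (standing for y_{j+1}).

data Var : Set where
  x : ℕ → Var
  y : ℕ → Var

-- A monomial is a multiset of variables (given as a list; order irrelevant).
Monomial : Set
Monomial = List Var

Poly : Set
Poly = List (ℤ × Monomial)

Assignment : Set
Assignment = Var → ℤ

prodℤ : List ℤ → ℤ
prodℤ []       = + 1
prodℤ (a ∷ as) = a * prodℤ as

evalMon : Assignment → Monomial → ℤ
evalMon ρ m = prodℤ (map ρ m)

eval : Assignment → Poly → ℤ
eval ρ []            = + 0
eval ρ ((c , m) ∷ p) = c * evalMon ρ m + eval ρ p

-- Reduced (normal-form) representation: nonzero coefficients, and no two
-- terms with the same monomial.  Such a representation is unique up to
-- reordering, so the bit size below is well defined.
Reduced : Poly → Set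
Reduced p = All (λ t → proj₁ t ≢ + 0) p
          × AllPairs (λ t u → ¬ (proj₂ t ↭ proj₂ u)) p

bits : ℤ → ℕ
bits c = ⌈log₂ (suc ∣ c ∣) ⌉

sizePoly : Poly → ℕ
sizePoly p = sum (map (λ t → bits (proj₁ t)) p)

size : List Poly → ℕ
size ls = sum (map sizePoly ls)

bvpSum : Assignment → ℕ → ℤ
bvpSum ρ zero    = + 0
bvpSum ρ (suc k) = bvpSum ρ k + (+ (2 ℕ.^ k)) * ρ (x k)

-- Extension definitions: the j-th entry (0-based) is q_j, which may only
-- mention original variables x_1..x_n and earlier extension variables.
Allowed : ℕ → ℕ → Var → Set
Allowed n j (x i) = i < n
Allowed n j (y k) = k < j

vars : Poly → List Var
vars p = concatMap proj₂ p

WFDefs : ℕ → List Poly → Set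
WFDefs n defs = (j : Fin (length defs)) →
  All (Allowed n (toℕ j)) (vars (lookup defs j))

-- Polynomial identities are expressed as identities of evaluations at all
-- integer points (equivalent to formal identity over the infinite domain ℤ).
data Rule (n M : ℕ) (defs : List Poly) (ls : List Poly) (p : Poly) : Set where
  bvp  : (∀ ρ → eval ρ p ≡ + M + bvpSum ρ n) → Rule n M defs ls p
  bool : (i : ℕ) → i < n →
         (∀ ρ → eval ρ p ≡ ρ (x i) * ρ (x i) - ρ (x i)) → Rule n M defs ls p
  ext  : (j : Fin (length defs)) →
         (∀ ρ → eval ρ p ≡ ρ (y (toℕ j)) - eval ρ (lookup defs j)) →
         Rule n M defs ls p
  lin  : (a b : ℤ) (l₁ l₂ : Poly) → l₁ ∈ ls → l₂ ∈ ls →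
         (∀ ρ → eval ρ p ≡ a * eval ρ l₁ + b * eval ρ l₂) → Rule n M defs ls p
  mul  : (v : Var) (l : Poly) → l ∈ ls →
         (∀ ρ → eval ρ p ≡ ρ v * eval ρ l) → Rule n M defs ls p
  sqrt : (l : Poly) → l ∈ ls →
         (∀ ρ → eval ρ p * eval ρ p ≡ eval ρ l) → Rule n M defs ls p

-- A derivation, as the list of its lines (most recent first); each line is
-- in reduced form and follows from earlier lines by a rule.
data Derivation (n M : ℕ) (defs : List Poly) : List Poly → Set where
  []  : Derivation n M defs []
  _∷_ : ∀ {p ls} → (Reduced p × Rule n M defs ls p) →
        Derivation n M defs ls → Derivation n M defs (p ∷ ls)

-- CNFs.  A literal (v , true) is the positive literal v, (v , false) is ¬v.

Literal : Set
Literal = Var × Bool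

Clause : Set
Clause = List Literal

CNF : Set
CNF = List Clause

litSat : (Var → Bool) → Literal → Set
litSat α (v , s) = α v ≡ s

Satisfies : (Var → Bool) → CNF → Set
Satisfies α F = All (λ C → Any (litSat α) C) F

Unsatisfiable : CNF → Set
Unsatisfiable F = ¬ (∃[ α ] Satisfies α F)

-- Polynomial encoding of a clause (evaluated): a positive literal v
-- contributes the factor ¬v = 1 - v, a negative literal ¬v contributes v;
-- the product vanishes (on Boolean points) iff the clause is satisfied.
litFactor : Assignment → Literal → ℤ
litFactor ρ (v , true)  = + 1 - ρ v
litFactor ρ (v , false) = ρ v

clauseEval : Assignment → Clause → ℤ
clauseEval ρ C = prodℤ (map (litFactor ρ) C)

DerivesMultiple : List Poly → (Assignment → ℤ) → Set
DerivesMultiple ls P =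
  ∃[ l ] (l ∈ ls × ∃[ c ] (c ≢ + 0 × (∀ ρ → eval ρ l ≡ c * P ρ)))

varsCNF : CNF → List Var
varsCNF F = concatMap (map proj₁) F

DerivesCNF : List Poly → CNF → Set
DerivesCNF ls F =
  All (λ C → DerivesMultiple ls (λ ρ → clauseEval ρ C)) F
  × All (λ v → DerivesMultiple ls (λ ρ → ρ v * ρ v - ρ v)) (varsCNF F)

{-# OPTIONS --safe #-}
module Submission where

-- At the point where every variable is −1 each monomial is ±1, so a line l of size s(l)
-- satisfies |l(−1)| < 2^s(l), and the product D of the nonzero values |l(−1)| is at most
-- 2^S for the total size S.  Every prime p ≤ 2^n divides D: otherwise take Boolean x with
-- M + Σ 2^i x_i ≡ 0 (mod p) (possible as p ≤ 2^n), extend it through the extension axioms,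
-- and observe that every rule preserves divisibility by p at this point (the square root
-- rule because p is prime).  A clause line c·C has p ∤ c since c·C(−1) divides D, hence p
-- divides C(x, y), and "v is true iff p ∤ v" satisfies every clause, which is impossible.
-- So every k in [2^(n−1), 2^n), a product of fewer than n primes ≤ 2^n, divides D^n; by the
-- finite difference identity Δ^m(1/t)(u) = m! / (u (u+1) ⋯ (u+m)) the least common
-- multiple of m+1, …, 2m+1 is at least 2^m.  Hence 2^(n−1) ≤ S n + 1, which gives
-- 2^n ≤ (2S)^3 once n ≥ 8.

open import Data.Nat
  using ( ℕ; zero; suc; _+_; _*_; _∸_; _^_; _⊔_; _!; ⌊_/2⌋; ⌈_/2⌉; _≤_; _<_; z≤n; s≤s
        ; NonZero; ≢-nonZero; ≢-nonZero⁻¹; >-nonZero; nonTrivial⇒n>1)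
open import Data.Nat.Properties
open import Data.Nat.Tactic.RingSolver using (solve-∀)
open import Data.Nat.Divisibility
  using (_∣_; _∣?_; _∣0; 1∣_; ∣1⇒≡1; ∣-trans; *-pres-∣; m∣m*n; n∣m*n; ∣m+n∣m⇒∣n)
open import Data.Nat.DivMod
  using ( _/_; _%_; m/n*n≡m; m<n⇒m%n≡m; m%n<n; m≡m%n+[m/n]*n; n%1≡0
        ; [m*n+o]%[p*n]≡[m*n]%[p*n]+o; m%n*o≡m*o%[n*o])
open import Data.Nat.ListAction using (product)
open import Data.Nat.ListAction.Properties using (∈⇒∣product)
open import Data.Nat.Logarithm.Core using (⌈log2⌉)
open import Data.Nat.Primality
  using (Prime; euclidsLemma; prime⇒nonZero; prime⇒nonTrivial; productOfPrimes≥1)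
open import Data.Nat.Primality.Factorisation using (factorise; PrimeFactorisation)
open import Data.Integer as ℤ using (ℤ; +_; ∣_∣)
import Data.Integer.Properties as ℤ
import Data.Integer.Tactic.RingSolver as ℤ
open import Data.Integer.Divisibility.Signed
  using (∣ᵤ⇒∣; ∣⇒∣ᵤ; ∣m∣n⇒∣m+n; ∣n⇒∣m*n; ∣m⇒∣m*n) renaming (_∣_ to _∣ℤ_)
open import Data.Bool using (Bool; true; false; not)
open import Data.Fin as Fin using (Fin; toℕ)
open import Data.Fin.Properties using (toℕ<n)
open import Data.List using (List; []; _∷_; length; map; lookup)
open import Data.List.Membership.Propositional using (_∈_)
open import Data.List.Membership.Propositional.Properties using (∈-map⁺)
open import Data.List.Relation.Unary.All as All using (All; []; _∷_)
open import Data.List.Relation.Unary.All.Properties using (++⁻ˡ; ++⁻ʳ)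
open import Data.List.Relation.Unary.Any using (Any; here; there)
open import Data.Product using (∃-syntax; _,_)
open import Data.Sum as Sum using (_⊎_; inj₁; inj₂)
open import Data.Empty using (⊥-elim)
open import Function using (id; _∘_)
open import Induction.WellFounded using (Acc; acc)
open import Relation.Binary.PropositionalEquality
open import Relation.Nullary using (¬_; yes; no; does)

open import Defs

rising : ℕ → ℕ → ℕ
rising u zero    = 1
rising u (suc k) = rising u k * (u + k)

rising-suc : ∀ u k → rising u (suc k) ≡ u * rising (suc u) k
rising-suc u zero    = trans (*-identityˡ (u + 0)) (trans (+-identityʳ u) (sym (*-identityʳ u)))
rising-suc u (suc k) = begin
  rising u (suc k) * (u + suc k)     ≡⟨ cong₂ _*_ (rising-suc u k) (+-suc u k) ⟩
  u * rising (suc u) k * suc (u + k) ≡⟨ *-assoc u _ _ ⟩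
  u * rising (suc u) (suc k)         ∎
  where open ≡-Reasoning

2^k*k!≤rising : ∀ {u} k → k < u → 2 ^ k * k ! ≤ rising u (suc k)
2^k*k!≤rising {u} zero 0<u = ≤-trans 0<u (≤-reflexive (sym (trans (*-identityˡ (u + 0)) (+-identityʳ u))))
2^k*k!≤rising {u} (suc k) k<u = begin
  2 * 2 ^ k * (suc k * k !)            ≡⟨ regroup (2 ^ k) (k !) k ⟩
  2 ^ k * k ! * (suc k + suc k)        ≤⟨ *-mono-≤ (2^k*k!≤rising k 1+k≤u) (+-monoˡ-≤ (suc k) 1+k≤u) ⟩
  rising u (suc k) * (u + suc k)       ∎
  where
  open ≤-Reasoning
  1+k≤u : suc k ≤ u
  1+k≤u = <⇒≤ k<u
  regroup : ∀ a b k → 2 * a * (suc k * b) ≡ a * b * (suc k + suc k)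
  regroup = solve-∀

difference : (ℕ → ℤ) → ℕ → ℕ → ℤ
difference f zero    u = f u
difference f (suc m) u = difference f m u ℤ.- difference f m (suc u)

difference-step : ∀ A B P Q a b {k} → A ℤ.* P ≡ k → B ℤ.* Q ≡ k → P ℤ.* (a ℤ.+ b) ≡ Q ℤ.* a →
                  (A ℤ.- B) ℤ.* (P ℤ.* (a ℤ.+ b)) ≡ k ℤ.* b
difference-step A B P Q a b {k} AP≡k BQ≡k P[a+b]≡Qa = begin
  (A ℤ.- B) ℤ.* (P ℤ.* (a ℤ.+ b))
    ≡⟨ expand A B P (a ℤ.+ b) ⟩
  A ℤ.* P ℤ.* (a ℤ.+ b) ℤ.- B ℤ.* (P ℤ.* (a ℤ.+ b))
    ≡⟨ cong₂ (λ s t → s ℤ.* (a ℤ.+ b) ℤ.- B ℤ.* t) AP≡k P[a+b]≡Qa ⟩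
  k ℤ.* (a ℤ.+ b) ℤ.- B ℤ.* (Q ℤ.* a)
    ≡⟨ cong (λ t → k ℤ.* (a ℤ.+ b) ℤ.- t) (sym (ℤ.*-assoc B Q a)) ⟩
  k ℤ.* (a ℤ.+ b) ℤ.- B ℤ.* Q ℤ.* a
    ≡⟨ cong (λ t → k ℤ.* (a ℤ.+ b) ℤ.- t ℤ.* a) BQ≡k ⟩
  k ℤ.* (a ℤ.+ b) ℤ.- k ℤ.* a
    ≡⟨ cancel k a b ⟩
  k ℤ.* b ∎
  where
  open ≡-Reasoning
  expand : ∀ A B P c → (A ℤ.- B) ℤ.* (P ℤ.* c) ≡ A ℤ.* P ℤ.* c ℤ.- B ℤ.* (P ℤ.* c)
  expand = ℤ.solve-∀
  cancel : ∀ k a b → k ℤ.* (a ℤ.+ b) ℤ.- k ℤ.* a ≡ k ℤ.* b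
  cancel = ℤ.solve-∀

-- On [u, u + m] the function f is X / t, and the m-th difference of t ↦ 1 / t at u
-- is m! / (u (u + 1) ⋯ (u + m)).
difference-reciprocal : ∀ f X m u → (∀ j → j ≤ m → f (u + j) ℤ.* + (u + j) ≡ + X) →
                        difference f m u ℤ.* + rising u (suc m) ≡ + (m ! * X)
difference-reciprocal f X zero u f≡X/ = begin
  f u ℤ.* + (1 * (u + 0))   ≡⟨ cong (λ t → f u ℤ.* + t) (*-identityˡ (u + 0)) ⟩
  f u ℤ.* + (u + 0)         ≡⟨ cong (λ t → f t ℤ.* + (u + 0)) (sym (+-identityʳ u)) ⟩
  f (u + 0) ℤ.* + (u + 0)   ≡⟨ f≡X/ 0 z≤n ⟩
  + X                       ≡⟨ cong +_ (sym (*-identityˡ X)) ⟩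
  + (1 * X)                 ∎
  where open ≡-Reasoning
difference-reciprocal f X (suc m) u f≡X/ = begin
  difference f (suc m) u ℤ.* + (P * (u + suc m))  ≡⟨ cong (difference f (suc m) u ℤ.*_) P[u+m+1] ⟩
  difference f (suc m) u ℤ.* (+ P ℤ.* (+ u ℤ.+ + suc m))
    ≡⟨ difference-step (difference f m u) (difference f m (suc u)) (+ P) (+ Q) (+ u) (+ suc m)
                       (difference-reciprocal f X m u (λ j j≤m → f≡X/ j (m≤n⇒m≤1+n j≤m)))
                       (difference-reciprocal f X m (suc u) shifted)
                       P[u+m+1]≡Qu ⟩
  + (m ! * X) ℤ.* + suc m                         ≡⟨ ℤ.pos-* (m ! * X) (suc m) ⟨
  + (m ! * X * suc m)                             ≡⟨ cong +_ (regroup (m !) X m) ⟩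
  + (suc m ! * X)                                 ∎
  where
  open ≡-Reasoning
  P Q : ℕ
  P = rising u (suc m)
  Q = rising (suc u) (suc m)
  P[u+m+1] : + (P * (u + suc m)) ≡ + P ℤ.* (+ u ℤ.+ + suc m)
  P[u+m+1] = trans (ℤ.pos-* P (u + suc m)) (cong (+ P ℤ.*_) (ℤ.pos-+ u (suc m)))
  P[u+m+1]≡Qu : + P ℤ.* (+ u ℤ.+ + suc m) ≡ + Q ℤ.* + u
  P[u+m+1]≡Qu = begin
    + P ℤ.* (+ u ℤ.+ + suc m) ≡⟨ P[u+m+1] ⟨
    + rising u (suc (suc m))  ≡⟨ cong +_ (trans (rising-suc u (suc m)) (*-comm u Q)) ⟩
    + (Q * u)                 ≡⟨ ℤ.pos-* Q u ⟩
    + Q ℤ.* + u               ∎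
  shifted : ∀ j → j ≤ m → f (suc u + j) ℤ.* + (suc u + j) ≡ + X
  shifted j j≤m = subst (λ t → f t ℤ.* + t ≡ + X) (+-suc u j) (f≡X/ (suc j) (s≤s j≤m))
  regroup : ∀ a b m → a * b * suc m ≡ suc m * a * b
  regroup = solve-∀

2^m≤commonMultiple : ∀ m {X} → 0 < X → (∀ j → j ≤ m → suc m + j ∣ X) → 2 ^ m ≤ X
2^m≤commonMultiple m {X} 0<X range∣X = *-cancelʳ-≤ (2 ^ m) X (m !) {{m !≢0}} (begin
  2 ^ m * m !                    ≤⟨ 2^k*k!≤rising m ≤-refl ⟩
  rising (suc m) (suc m)         ≤⟨ m≤n*m _ ∣ d ∣ {{≢-nonZero ∣d∣≢0}} ⟩
  ∣ d ∣ * rising (suc m) (suc m) ≡⟨ ∣d∣*rising≡m!*X ⟩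
  m ! * X                        ≡⟨ *-comm (m !) X ⟩
  X * m !                        ∎)
  where
  open ≤-Reasoning
  X/ : ℕ → ℤ
  X/ zero    = + 0
  X/ (suc t) = + (X / suc t)
  d : ℤ
  d = difference X/ m (suc m)
  ∣d∣*rising≡m!*X : ∣ d ∣ * rising (suc m) (suc m) ≡ m ! * X
  ∣d∣*rising≡m!*X = trans (sym (ℤ.abs-* d _)) (cong ∣_∣ (difference-reciprocal X/ X m (suc m)
    (λ j j≤m → trans (sym (ℤ.pos-* (X / (suc m + j)) (suc m + j))) (cong +_ (m/n*n≡m (range∣X j j≤m))))))
  ∣d∣≢0 : ∣ d ∣ ≢ 0
  ∣d∣≢0 ∣d∣≡0 = <⇒≢ (*-mono-≤ (1≤n! m) 0<X) (sym (trans (sym ∣d∣*rising≡m!*X) (cong (_* _) ∣d∣≡0)))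

productOfPrimes∣^ : ∀ {B D} t {ps} → All Prime ps → product ps ≤ B → product ps < 2 ^ t →
                    (∀ {p} → Prime p → p ≤ B → p ∣ D) → product ps ∣ D ^ t
productOfPrimes∣^ t       {[]}     _          _      _         _ = 1∣ _
productOfPrimes∣^ zero    {p ∷ ps} prime[ps]  _      Πps<1     _ =
  ⊥-elim (<⇒≱ Πps<1 (productOfPrimes≥1 prime[ps]))
productOfPrimes∣^ (suc t) {p ∷ ps} (p-prime ∷ ps-prime) p*Π≤B  p*Π<2^t+1 primes∣D =
  *-pres-∣ (primes∣D p-prime (≤-trans (m≤m*n p (product ps)) p*Π≤B))
           (productOfPrimes∣^ t ps-prime (≤-trans (m≤n*m (product ps) p) p*Π≤B) Π<2^t primes∣D)
  where
  instance
    _ = prime⇒nonZero p-prime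
    _ = >-nonZero (productOfPrimes≥1 ps-prime)
  Π<2^t : product ps < 2 ^ t
  Π<2^t = *-cancelˡ-< 2 _ _
    (≤-<-trans (*-monoˡ-≤ (product ps) (nonTrivial⇒n>1 p {{prime⇒nonTrivial p-prime}})) p*Π<2^t+1)

primes∣⇒∣^ : ∀ {B D} t {k} → 0 < k → k ≤ B → k < 2 ^ t →
             (∀ {p} → Prime p → p ≤ B → p ∣ D) → k ∣ D ^ t
primes∣⇒∣^ t {k} 0<k k≤B k<2^t primes∣D =
  subst (_∣ _) (sym isFactorisation)
    (productOfPrimes∣^ t factorsPrime (subst (_≤ _) isFactorisation k≤B)
                                      (subst (_< _) isFactorisation k<2^t) primes∣D)
  where open PrimeFactorisation (factorise k {{>-nonZero 0<k}})

primes≤2^[1+n]∣⇒2^n≤1+s[1+n] : ∀ n {D s} → 0 < D → D ≤ 2 ^ s →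
                                (∀ {p} → Prime p → p ≤ 2 ^ suc n → p ∣ D) → 2 ^ n ≤ suc (s * suc n)
primes≤2^[1+n]∣⇒2^n≤1+s[1+n] n {D} {s} 0<D D≤2^s primes∣D = begin
  2 ^ n           ≡⟨ 1+m≡2^n ⟨
  suc m           ≤⟨ s≤s m≤s[1+n] ⟩
  suc (s * suc n) ∎
  where
  open ≤-Reasoning
  m : ℕ
  m = 2 ^ n ∸ 1
  1+m≡2^n : suc m ≡ 2 ^ n
  1+m≡2^n = m+[n∸m]≡n (m^n>0 2 n)
  range∣D^[1+n] : ∀ j → j ≤ m → suc m + j ∣ D ^ suc n
  range∣D^[1+n] j j≤m = primes∣⇒∣^ (suc n) (s≤s z≤n) (<⇒≤ k<2^[1+n]) k<2^[1+n] primes∣D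
    where
    k<2^[1+n] : suc m + j < 2 ^ suc n
    k<2^[1+n] = begin-strict
      suc m + j       ≤⟨ +-monoʳ-≤ (suc m) j≤m ⟩
      suc m + m       <⟨ +-monoʳ-< (suc m) (n<1+n m) ⟩
      suc m + suc m   ≡⟨ cong₂ _+_ 1+m≡2^n (trans 1+m≡2^n (sym (+-identityʳ (2 ^ n)))) ⟩
      2 ^ suc n       ∎
  2^m≤2^[s*[1+n]] : 2 ^ m ≤ 2 ^ (s * suc n)
  2^m≤2^[s*[1+n]] = begin
    2 ^ m           ≤⟨ 2^m≤commonMultiple m (m^n>0 D {{>-nonZero 0<D}} (suc n)) range∣D^[1+n] ⟩
    D ^ suc n       ≤⟨ ^-monoˡ-≤ (suc n) D≤2^s ⟩
    (2 ^ s) ^ suc n ≡⟨ ^-*-assoc 2 s (suc n) ⟩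
    2 ^ (s * suc n) ∎
  m≤s[1+n] : m ≤ s * suc n
  m≤s[1+n] = ≮⇒≥ (λ lt → <⇒≱ (^-monoʳ-< 2 (s≤s (s≤s z≤n)) lt) 2^m≤2^[s*[1+n]])

[2+n]²≤2^n : ∀ {n} → 7 ≤ n → (2 + n) * (2 + n) ≤ 2 ^ n
[2+n]²≤2^n 7≤n with m≤n⇒∃[o]m+o≡n 7≤n
... | k , refl = [9+k]²≤2^[7+k] k
  where
  [9+k]²≤2^[7+k] : ∀ k → (9 + k) * (9 + k) ≤ 2 ^ (7 + k)
  [9+k]²≤2^[7+k] zero    = m≤m+n 81 47
  [9+k]²≤2^[7+k] (suc k) = begin
    (10 + k) * (10 + k)                          ≤⟨ m≤m+n _ (62 + 16 * k + k * k) ⟩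
    (10 + k) * (10 + k) + (62 + 16 * k + k * k)  ≡⟨ expand k ⟩
    2 * ((9 + k) * (9 + k))                      ≤⟨ *-monoʳ-≤ 2 ([9+k]²≤2^[7+k] k) ⟩
    2 * 2 ^ (7 + k)                              ∎
    where
    open ≤-Reasoning
    expand : ∀ k → (10 + k) * (10 + k) + (62 + 16 * k + k * k) ≡ 2 * ((9 + k) * (9 + k))
    expand = solve-∀

2^n≤1+s[1+n]⇒2^[1+n]≤[2s]³ : ∀ {n} s → 7 ≤ n → 2 ^ n ≤ suc (s * suc n) → 2 ^ suc n ≤ (2 * s) ^ 3
2^n≤1+s[1+n]⇒2^[1+n]≤[2s]³ zero 7≤n 2^n≤1 =
  ⊥-elim (<⇒≱ (^-monoʳ-< 2 (s≤s (s≤s z≤n)) (≤-trans (s≤s z≤n) 7≤n)) 2^n≤1)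
2^n≤1+s[1+n]⇒2^[1+n]≤[2s]³ {n} s@(suc _) 7≤n 2^n≤1+s[1+n] = begin
  2 * 2 ^ n             ≤⟨ *-monoʳ-≤ 2 (≤-trans 2^n≤s[2+n] (*-monoʳ-≤ s 2+n≤s)) ⟩
  2 * (s * s)           ≤⟨ m≤m*n (2 * (s * s)) (4 * s) ⟩
  2 * (s * s) * (4 * s) ≡⟨ cube s ⟩
  (2 * s) ^ 3           ∎
  where
  open ≤-Reasoning
  2^n≤s[2+n] : 2 ^ n ≤ s * (2 + n)
  2^n≤s[2+n] = ≤-trans 2^n≤1+s[1+n]
    (≤-trans (+-monoˡ-≤ (s * suc n) (s≤s z≤n)) (≤-reflexive (sym (*-suc s (suc n)))))
  2+n≤s : 2 + n ≤ s
  2+n≤s = *-cancelʳ-≤ (2 + n) s (2 + n) (≤-trans ([2+n]²≤2^n 7≤n) 2^n≤s[2+n])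
  cube : ∀ s → 2 * (s * s) * (4 * s) ≡ 2 * s * (2 * s * (2 * s * 1))
  cube = solve-∀

n≤2^⌈log2⌉n : ∀ n (acc : Acc _<_ n) → n ≤ 2 ^ ⌈log2⌉ n acc
n≤2^⌈log2⌉n zero                _          = z≤n
n≤2^⌈log2⌉n (suc zero)          _          = s≤s z≤n
n≤2^⌈log2⌉n (suc (suc n)) (acc rs) = begin
  2 + n                    ≡⟨ cong (_+_ 2) (⌊n/2⌋+⌈n/2⌉≡n n) ⟨
  2 + (⌊ n /2⌋ + h)        ≤⟨ +-monoʳ-≤ 2 (+-monoˡ-≤ h (⌊n/2⌋≤⌈n/2⌉ n)) ⟩
  2 + (h + h)              ≡⟨ double h ⟩
  2 * suc h                ≤⟨ *-monoʳ-≤ 2 (n≤2^⌈log2⌉n (suc h) _) ⟩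
  2 * 2 ^ ⌈log2⌉ (suc h) _ ∎
  where
  open ≤-Reasoning
  h : ℕ
  h = ⌈ n /2⌉
  double : ∀ h → 2 + (h + h) ≡ 2 * suc h
  double = solve-∀

minusOne : Assignment
minusOne _ = ℤ.-1ℤ

∣evalMon-minusOne∣≡1 : ∀ m → ∣ evalMon minusOne m ∣ ≡ 1
∣evalMon-minusOne∣≡1 []      = refl
∣evalMon-minusOne∣≡1 (v ∷ m) =
  trans (ℤ.abs-* ℤ.-1ℤ (evalMon minusOne m)) (cong (1 *_) (∣evalMon-minusOne∣≡1 m))

1+∣eval-minusOne∣≤2^sizePoly : ∀ l → suc ∣ eval minusOne l ∣ ≤ 2 ^ sizePoly l
1+∣eval-minusOne∣≤2^sizePoly []            = s≤s z≤n
1+∣eval-minusOne∣≤2^sizePoly ((c , m) ∷ l) = begin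
  suc ∣ c ℤ.* μ ℤ.+ e ∣               ≤⟨ s≤s (ℤ.∣i+j∣≤∣i∣+∣j∣ (c ℤ.* μ) e) ⟩
  suc (∣ c ℤ.* μ ∣ + ∣ e ∣)           ≡⟨ cong (λ t → suc (t + ∣ e ∣)) ∣cμ∣≡∣c∣ ⟩
  suc (∣ c ∣ + ∣ e ∣)                 ≤⟨ m≤m+n _ (∣ c ∣ * ∣ e ∣) ⟩
  suc (∣ c ∣ + ∣ e ∣) + ∣ c ∣ * ∣ e ∣ ≡⟨ expand ∣ c ∣ ∣ e ∣ ⟩
  suc ∣ c ∣ * suc ∣ e ∣
    ≤⟨ *-mono-≤ (n≤2^⌈log2⌉n (suc ∣ c ∣) _) (1+∣eval-minusOne∣≤2^sizePoly l) ⟩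
  2 ^ bits c * 2 ^ sizePoly l         ≡⟨ ^-distribˡ-+-* 2 (bits c) (sizePoly l) ⟨
  2 ^ sizePoly ((c , m) ∷ l)          ∎
  where
  open ≤-Reasoning
  μ e : ℤ
  μ = evalMon minusOne m
  e = eval minusOne l
  ∣cμ∣≡∣c∣ : ∣ c ℤ.* μ ∣ ≡ ∣ c ∣
  ∣cμ∣≡∣c∣ = trans (ℤ.abs-* c μ) (trans (cong (∣ c ∣ *_) (∣evalMon-minusOne∣≡1 m)) (*-identityʳ ∣ c ∣))
  expand : ∀ a b → suc (a + b) + a * b ≡ suc a * suc b
  expand = solve-∀

certificate : List Poly → ℕ
certificate ls = product (map (λ l → 1 ⊔ ∣ eval minusOne l ∣) ls)

0<certificate : ∀ ls → 0 < certificate ls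
0<certificate []       = s≤s z≤n
0<certificate (l ∷ ls) = *-mono-≤ (m≤m⊔n 1 ∣ eval minusOne l ∣) (0<certificate ls)

certificate≤2^size : ∀ ls → certificate ls ≤ 2 ^ size ls
certificate≤2^size []       = s≤s z≤n
certificate≤2^size (l ∷ ls) = begin
  (1 ⊔ ∣ eval minusOne l ∣) * certificate ls
    ≤⟨ *-mono-≤ (⊔-lub (s≤s z≤n) (n≤1+n ∣ eval minusOne l ∣)) (certificate≤2^size ls) ⟩
  suc ∣ eval minusOne l ∣ * 2 ^ size ls     ≤⟨ *-monoˡ-≤ (2 ^ size ls) (1+∣eval-minusOne∣≤2^sizePoly l) ⟩
  2 ^ sizePoly l * 2 ^ size ls              ≡⟨ ^-distribˡ-+-* 2 (sizePoly l) (size ls) ⟨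
  2 ^ size (l ∷ ls)                         ∎
  where open ≤-Reasoning

∣eval-minusOne∣∣certificate : ∀ {l ls} → l ∈ ls → 0 < ∣ eval minusOne l ∣ →
                              ∣ eval minusOne l ∣ ∣ certificate ls
∣eval-minusOne∣∣certificate l∈ls 0<∣l∣ =
  subst (_∣ _) (m≤n⇒m⊔n≡n 0<∣l∣) (∈⇒∣product (∈-map⁺ (λ l → 1 ⊔ ∣ eval minusOne l ∣) l∈ls))

module _ {p : ℕ} (p-prime : Prime p) where

  p∣*⇒p∣⊎p∣ : ∀ a b → + p ∣ℤ a ℤ.* b → + p ∣ℤ a ⊎ + p ∣ℤ b
  p∣*⇒p∣⊎p∣ a b p∣ab =
    Sum.map ∣ᵤ⇒∣ ∣ᵤ⇒∣ (euclidsLemma ∣ a ∣ ∣ b ∣ p-prime (subst (p ∣_) (ℤ.abs-* a b) (∣⇒∣ᵤ p∣ab)))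

  p∣²⇒p∣ : ∀ a → + p ∣ℤ a ℤ.* a → + p ∣ℤ a
  p∣²⇒p∣ a p∣a² = Sum.[ id , id ] (p∣*⇒p∣⊎p∣ a a p∣a²)

  lines-divisible : ∀ {n M defs ls} (σ : Assignment) → Derivation n M defs ls →
                    + p ∣ℤ + M ℤ.+ bvpSum σ n →
                    (∀ i → i < n → σ (x i) ℤ.* σ (x i) ℤ.- σ (x i) ≡ + 0) →
                    (∀ j → σ (y (toℕ j)) ℤ.- eval σ (lookup defs j) ≡ + 0) →
                    All (λ l → + p ∣ℤ eval σ l) ls
  lines-divisible σ []            _      _       _      = []
  lines-divisible σ ((_ , r) ∷ d) p∣bvp boolean extends = rule r ∷ earlier
    where
    earlier = lines-divisible σ d p∣bvp boolean extends
    p∣0 : + p ∣ℤ + 0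
    p∣0 = ∣ᵤ⇒∣ (p ∣0)
    rule : ∀ {l} → Rule _ _ _ _ l → + p ∣ℤ eval σ l
    rule (bvp e)          = subst (+ p ∣ℤ_) (sym (e σ)) p∣bvp
    rule (bool i i<n e)   = subst (+ p ∣ℤ_) (sym (trans (e σ) (boolean i i<n))) p∣0
    rule (ext j e)        = subst (+ p ∣ℤ_) (sym (trans (e σ) (extends j))) p∣0
    rule (lin a b _ _ l₁∈ l₂∈ e) = subst (+ p ∣ℤ_) (sym (e σ))
      (∣m∣n⇒∣m+n (∣n⇒∣m*n a (All.lookup earlier l₁∈)) (∣n⇒∣m*n b (All.lookup earlier l₂∈)))
    rule (mul v _ l∈ e)   = subst (+ p ∣ℤ_) (sym (e σ)) (∣n⇒∣m*n (σ v) (All.lookup earlier l∈))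
    rule {l} (sqrt _ l∈ e) = p∣²⇒p∣ (eval σ l) (subst (+ p ∣ℤ_) (sym (e σ)) (All.lookup earlier l∈))

evalMon-cong : ∀ {ρ ρ′} m → All (λ v → ρ v ≡ ρ′ v) m → evalMon ρ m ≡ evalMon ρ′ m
evalMon-cong []      []       = refl
evalMon-cong (v ∷ m) (e ∷ es) = cong₂ ℤ._*_ e (evalMon-cong m es)

eval-cong : ∀ {ρ ρ′} q → All (λ v → ρ v ≡ ρ′ v) (vars q) → eval ρ q ≡ eval ρ′ q
eval-cong []            _     = refl
eval-cong ((c , m) ∷ q) agree =
  cong₂ ℤ._+_ (cong (c ℤ.*_) (evalMon-cong m (++⁻ˡ m agree))) (eval-cong q (++⁻ʳ m agree))

-- Indexing with a junk value [] past the end keeps the stages below total.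
nth : List Poly → ℕ → Poly
nth []       _       = []
nth (q ∷ qs) zero    = q
nth (q ∷ qs) (suc k) = nth qs k

nth-lookup : ∀ qs (j : Fin (length qs)) → nth qs (toℕ j) ≡ lookup qs j
nth-lookup (q ∷ qs) Fin.zero    = refl
nth-lookup (q ∷ qs) (Fin.suc j) = nth-lookup qs j

setY : Assignment → ℕ → ℤ → Assignment
setY ρ k z (x i) = ρ (x i)
setY ρ k z (y j) with j ≟ k
... | yes _ = z
... | no  _ = ρ (y j)

stage : (ℕ → ℤ) → List Poly → ℕ → Assignment
stage b defs zero    (x i) = b i
stage b defs zero    (y j) = + 0
stage b defs (suc k)       = setY (stage b defs k) k (eval (stage b defs k) (nth defs k))

stage-x : ∀ b defs k i → stage b defs k (x i) ≡ b i
stage-x b defs zero    i = refl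
stage-x b defs (suc k) i = stage-x b defs k i

stage-y : ∀ b defs {k j} → j < k → stage b defs k (y j) ≡ eval (stage b defs j) (nth defs j)
stage-y b defs {suc k} {j} j<1+k with j ≟ k
... | yes refl = refl
... | no  j≢k  = stage-y b defs (≤∧≢⇒< (≤-pred j<1+k) j≢k)

module _ {n} (b : ℕ → ℤ) (defs : List Poly) (wf : WFDefs n defs) where

  extension : Assignment
  extension = stage b defs (length defs)

  extension-x : ∀ i → extension (x i) ≡ b i
  extension-x = stage-x b defs (length defs)

  -- By well-formedness, q_j only sees variables that are already fixed at stage j.
  extension-defines : ∀ j → extension (y (toℕ j)) ℤ.- eval extension (lookup defs j) ≡ + 0
  extension-defines j = begin
    extension (y (toℕ j)) ℤ.- eval extension (lookup defs j)
      ≡⟨ cong₂ ℤ._-_ (trans (stage-y b defs (toℕ<n j)) (cong (eval σⱼ) (nth-lookup defs j)))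
                     (eval-cong (lookup defs j) (All.map (λ {v} → agree v) (wf j))) ⟩
    eval σⱼ (lookup defs j) ℤ.- eval σⱼ (lookup defs j)
      ≡⟨ ℤ.+-inverseʳ (eval σⱼ (lookup defs j)) ⟩
    + 0 ∎
    where
    open ≡-Reasoning
    σⱼ : Assignment
    σⱼ = stage b defs (toℕ j)
    agree : ∀ v → Allowed n (toℕ j) v → extension v ≡ σⱼ v
    agree (x i) _   = trans (extension-x i) (sym (stage-x b defs (toℕ j) i))
    agree (y k) k<j = trans (stage-y b defs (<-trans k<j (toℕ<n j))) (sym (stage-y b defs k<j))

digit : ℕ → ℕ → ℕ
digit a i = a / 2 ^ i % 2
  where instance _ = m^n≢0 2 i

digit<2 : ∀ a i → digit a i < 2
digit<2 a i = m%n<n (a / 2 ^ i) 2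
  where instance _ = m^n≢0 2 i

m%[2*n] : ∀ m n .{{_ : NonZero n}} .{{_ : NonZero (2 * n)}} → m % (2 * n) ≡ m / n % 2 * n + m % n
m%[2*n] m n = begin
  m % (2 * n)                       ≡⟨ cong (_% (2 * n)) m≡[m/n]*n+m%n ⟩
  (m / n * n + m % n) % (2 * n)     ≡⟨ [m*n+o]%[p*n]≡[m*n]%[p*n]+o (m / n) 2 (m%n<n m n) ⟩
  m / n * n % (2 * n) + m % n       ≡⟨ cong (_+ m % n) (m%n*o≡m*o%[n*o] (m / n) 2 n) ⟨
  m / n % 2 * n + m % n             ∎
  where
  open ≡-Reasoning
  m≡[m/n]*n+m%n : m ≡ m / n * n + m % n
  m≡[m/n]*n+m%n = trans (m≡m%n+[m/n]*n m n) (+-comm (m % n) _)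

bvpSum-digits : ∀ {ρ} a → (∀ i → ρ (x i) ≡ + digit a i) →
                ∀ k → bvpSum ρ k ≡ + (a % 2 ^ k) {{m^n≢0 2 k}}
bvpSum-digits a digits zero    = sym (cong +_ (n%1≡0 a))
bvpSum-digits {ρ} a digits (suc k) = begin
  bvpSum ρ k ℤ.+ + 2 ^ k ℤ.* ρ (x k)
    ≡⟨ cong₂ (λ s t → s ℤ.+ + 2 ^ k ℤ.* t) (bvpSum-digits a digits k) (digits k) ⟩
  + (a % 2 ^ k) ℤ.+ + 2 ^ k ℤ.* + digit a k
    ≡⟨ cong (ℤ._+_ (+ (a % 2 ^ k))) (ℤ.pos-* (2 ^ k) (digit a k)) ⟨
  + (a % 2 ^ k) ℤ.+ + (2 ^ k * digit a k)
    ≡⟨ ℤ.pos-+ (a % 2 ^ k) _ ⟨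
  + (a % 2 ^ k + 2 ^ k * digit a k)
    ≡⟨ cong +_ (trans (+-comm (a % 2 ^ k) _) (sym a%2^[1+k])) ⟩
  + (a % 2 ^ suc k)                                   ∎
  where
  open ≡-Reasoning
  instance
    _ = m^n≢0 2 k
    _ = m^n≢0 2 (suc k)
  a%2^[1+k] : a % 2 ^ suc k ≡ 2 ^ k * digit a k + a % 2 ^ k
  a%2^[1+k] = trans (m%[2*n] a (2 ^ k)) (cong (_+ a % 2 ^ k) (*-comm (digit a k) (2 ^ k)))

digit²≡digit : ∀ a i → + digit a i ℤ.* + digit a i ℤ.- + digit a i ≡ + 0
digit²≡digit a i with digit a i | digit<2 a i
... | 0 | _ = refl
... | 1 | _ = refl
... | suc (suc _) | s≤s (s≤s ())

1+q∣m+[q*m]%[1+q] : ∀ q m → suc q ∣ m + q * m % suc q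
1+q∣m+[q*m]%[1+q] q m = ∣m+n∣m⇒∣n (subst (suc q ∣_) [1+q]*m≡ (m∣m*n m)) (n∣m*n (q * m / suc q))
  where
  rotate : ∀ a b c → a + (b + c) ≡ c + (a + b)
  rotate = solve-∀
  [1+q]*m≡ : suc q * m ≡ q * m / suc q * suc q + (m + q * m % suc q)
  [1+q]*m≡ = trans (cong (_+_ m) (m≡m%n+[m/n]*n (q * m) (suc q)))
                   (rotate m (q * m % suc q) (q * m / suc q * suc q))

∣clauseEval-minusOne∣>0 : ∀ C → 0 < ∣ clauseEval minusOne C ∣
∣clauseEval-minusOne∣>0 []      = s≤s z≤n
∣clauseEval-minusOne∣>0 (ℓ ∷ C) =
  subst (0 <_) (sym (ℤ.abs-* (litFactor minusOne ℓ) _))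
        (*-mono-≤ (∣litFactor∣>0 ℓ) (∣clauseEval-minusOne∣>0 C))
  where
  ∣litFactor∣>0 : ∀ ℓ → 0 < ∣ litFactor minusOne ℓ ∣
  ∣litFactor∣>0 (_ , true)  = s≤s z≤n
  ∣litFactor∣>0 (_ , false) = s≤s z≤n

module _ {p : ℕ} (p-prime : Prime p) (σ : Assignment) where

  nonMultiple : Var → Bool
  nonMultiple v = not (does (p ∣? ∣ σ v ∣))

  p∤1 : ¬ (+ p ∣ℤ + 1)
  p∤1 p∣1 = <⇒≢ (nonTrivial⇒n>1 p {{prime⇒nonTrivial p-prime}}) (sym (∣1⇒≡1 (∣⇒∣ᵤ p∣1)))

  p∣litFactor⇒litSat : ∀ ℓ → + p ∣ℤ litFactor σ ℓ → litSat nonMultiple ℓ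
  p∣litFactor⇒litSat (v , true) p∣1-σv with p ∣? ∣ σ v ∣
  ... | yes p∣σv = ⊥-elim (p∤1 (subst (+ p ∣ℤ_) (1-a+a≡1 (σ v)) (∣m∣n⇒∣m+n p∣1-σv (∣ᵤ⇒∣ p∣σv))))
    where
    1-a+a≡1 : ∀ a → + 1 ℤ.- a ℤ.+ a ≡ + 1
    1-a+a≡1 = ℤ.solve-∀
  ... | no  _    = refl
  p∣litFactor⇒litSat (v , false) p∣σv with p ∣? ∣ σ v ∣
  ... | yes _    = refl
  ... | no  p∤σv = ⊥-elim (p∤σv (∣⇒∣ᵤ p∣σv))

  p∣clauseEval⇒satisfied : ∀ C → + p ∣ℤ clauseEval σ C → Any (litSat nonMultiple) C
  p∣clauseEval⇒satisfied []      p∣1 = ⊥-elim (p∤1 p∣1)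
  p∣clauseEval⇒satisfied (ℓ ∷ C) p∣ℓC with p∣*⇒p∣⊎p∣ p-prime (litFactor σ ℓ) (clauseEval σ C) p∣ℓC
  ... | inj₁ p∣ℓ = here (p∣litFactor⇒litSat ℓ p∣ℓ)
  ... | inj₂ p∣C = there (p∣clauseEval⇒satisfied C p∣C)

  -- The multiplier c of the clause line is prime to p: the line's value at the all-(−1)
  -- point is a nonzero multiple of c and divides the certificate.
  p∣clauseEval : ∀ {ls} C → DerivesMultiple ls (λ ρ → clauseEval ρ C) →
                 All (λ l → + p ∣ℤ eval σ l) ls → ¬ p ∣ certificate ls → + p ∣ℤ clauseEval σ C
  p∣clauseEval C (l , l∈ls , c , c≢0 , l≡cC) lines p∤certificate
    with p∣*⇒p∣⊎p∣ p-prime c (clauseEval σ C) (subst (+ p ∣ℤ_) (l≡cC σ) (All.lookup lines l∈ls))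
  ... | inj₂ p∣C = p∣C
  ... | inj₁ p∣c = ⊥-elim (p∤certificate (∣-trans p∣∣l∣ (∣eval-minusOne∣∣certificate l∈ls 0<∣l∣)))
    where
    0<∣l∣ : 0 < ∣ eval minusOne l ∣
    0<∣l∣ = subst (0 <_) (sym (trans (cong ∣_∣ (l≡cC minusOne)) (ℤ.abs-* c _)))
      (*-mono-≤ (n≢0⇒n>0 (c≢0 ∘ ℤ.∣i∣≡0⇒i≡0)) (∣clauseEval-minusOne∣>0 C))
    p∣∣l∣ : p ∣ ∣ eval minusOne l ∣
    p∣∣l∣ = ∣⇒∣ᵤ (subst (+ p ∣ℤ_) (sym (l≡cC minusOne)) (∣m⇒∣m*n (clauseEval minusOne C) p∣c))

prime∣certificate : ∀ {n M defs ls F} → WFDefs n defs → Derivation n M defs ls → Unsatisfiable F →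
                    All (λ C → DerivesMultiple ls (λ ρ → clauseEval ρ C)) F →
                    ∀ {p} → Prime p → p ≤ 2 ^ n → p ∣ certificate ls
prime∣certificate _ _ _ _ {zero} p-prime _ =
  ⊥-elim (≢-nonZero⁻¹ 0 {{prime⇒nonZero p-prime}} refl)
prime∣certificate {n} {M} {defs} {ls} wf der unsat clauses {suc q} p-prime p≤2^n
  with suc q ∣? certificate ls
... | yes p∣certificate = p∣certificate
... | no  p∤certificate =
  ⊥-elim (unsat (nonMultiple p-prime σ ,
    All.map (λ {C} C-line → p∣clauseEval⇒satisfied p-prime σ C
                              (p∣clauseEval p-prime σ C C-line lines p∤certificate)) clauses))
  where
  a : ℕ
  a = q * M % suc q
  σ : Assignment
  σ = extension (λ i → + digit a i) defs wf
  bvpSum≡a : bvpSum σ n ≡ + a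
  bvpSum≡a = trans (bvpSum-digits a (extension-x _ defs wf) n)
                   (cong +_ (m<n⇒m%n≡m (<-≤-trans (m%n<n (q * M) (suc q)) p≤2^n)))
    where instance _ = m^n≢0 2 n
  p∣bvp : + suc q ∣ℤ + M ℤ.+ bvpSum σ n
  p∣bvp = subst (+ suc q ∣ℤ_) (trans (ℤ.pos-+ M a) (cong (ℤ._+_ (+ M)) (sym bvpSum≡a)))
                (∣ᵤ⇒∣ (1+q∣m+[q*m]%[1+q] q M))
  boolean : ∀ i → i < n → σ (x i) ℤ.* σ (x i) ℤ.- σ (x i) ≡ + 0
  boolean i _ = subst (λ z → z ℤ.* z ℤ.- z ≡ + 0) (sym (extension-x _ defs wf i)) (digit²≡digit a i)
  lines : All (λ l → + suc q ∣ℤ eval σ l) ls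
  lines = lines-divisible p-prime σ der p∣bvp boolean (extension-defines _ defs wf)

corollary2 : ∃[ K ] ∃[ N ] ((n : ℕ) → N ≤ n → (M : ℕ) → 0 < M →
               (defs : List Poly) → WFDefs n defs →
               (ls : List Poly) → Derivation n M defs ls →
               (F : CNF) → Unsatisfiable F → DerivesCNF ls F →
               2 ^ n ≤ (K * size ls) ^ 3)
corollary2 = 2 , 8 , λ where
  (suc n) (s≤s 7≤n) M _ defs wf ls der F unsat (clauses , _) →
    2^n≤1+s[1+n]⇒2^[1+n]≤[2s]³ (size ls) 7≤n
      (primes≤2^[1+n]∣⇒2^n≤1+s[1+n] n {s = size ls} (0<certificate ls) (certificate≤2^size ls)
        (prime∣certificate wf der unsat clauses))
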